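{- Let $\mathcal{K}$ be the class of all finite undirected simple acyclic graphs (finite forests) in which every vertex carries exactly one label from $\mathbb{Z}/5\mathbb{Z}$, such that no vertex with label $i$ has both a neighbor with label $i+1$ and a neighbor with label $i+2$ (addition modulo $5$). Then $\mathcal{K}$ has the weak amalgamation property.
   Context: Vertex-labeled graphs are regarded as relational structures (edge relation plus one unary predicate per label); an embedding is an injective map preserving and reflecting adjacency and preserving labels. A class $\mathcal{F}$ of finite structures has the weak amalgamation property (WAP) if for every $Z\in\mathcal{F}$ there is $Z'\in\mathcal{F}$ containing $Z$ as a substructure such that for all embeddings $f\colon Z'\to X$, $g\colon Z'\to Y$ with $X,Y\in\mathcal{F}$ there exist $W\in\mathcal{F}$ and embeddings $f'\colon X\to W$, $g'\colon Y\to W$ with $f'\circ f\restriction Z=g'\circ g\restriction Z$. -}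

module Defs where

open import Data.Nat using (ℕ; zero; suc; _+_)
open import Data.Nat.DivMod using (_mod_)
open import Data.Fin using (Fin; toℕ)
open import Data.Bool using (Bool; true; false)
open import Data.Product using (Σ; ∃; _×_; _,_; proj₁; proj₂)
open import Relation.Binary.PropositionalEquality using (_≡_)
open import Relation.Nullary using (¬_)
open import Data.Empty using (⊥)
open import Function.Definitions using (Injective)

ℤ₅ : Set
ℤ₅ = Fin 5

_+₅_ : ℤ₅ → ℕ → ℤ₅
i +₅ k = (toℕ i + k) mod 5

record LGraph : Set where
  field
    size  : ℕ
    adj   : Fin size → Fin size → Bool
    label : Fin size → ℤ₅
    adj-sym   : ∀ x y → adj x y ≡ adj y x
    adj-irrefl : ∀ x → adj x x ≡ false
open LGraph public

nextC : ∀ k → Fin (suc (suc (suc k))) → Fin (suc (suc (suc k)))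
nextC k i = (toℕ i + 1) mod (suc (suc (suc k)))

record Cycle (G : LGraph) : Set where
  field
    len-3 : ℕ
    verts : Fin (suc (suc (suc len-3))) → Fin (size G)
    distinct : Injective _≡_ _≡_ verts
    closed : ∀ i → adj G (verts i) (verts (nextC len-3 i)) ≡ true

Acyclic : LGraph → Set
Acyclic G = ¬ Cycle G

LabelCond : LGraph → Set
LabelCond G = ∀ u v w → adj G u v ≡ true → adj G u w ≡ true →
  label G v ≡ label G u +₅ 1 → label G w ≡ label G u +₅ 2 → ⊥

InK : LGraph → Set
InK G = Acyclic G × LabelCond G

record Emb (G H : LGraph) : Set where
  field
    map : Fin (size G) → Fin (size H)
    inj : Injective _≡_ _≡_ map
    adj-pres : ∀ x y → adj H (map x) (map y) ≡ adj G x y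
    label-pres : ∀ x → label H (map x) ≡ label G x
open Emb public

WAP : (LGraph → Set) → Set
WAP 𝓕 = ∀ (Z : LGraph) → 𝓕 Z →
  Σ LGraph λ Z' → 𝓕 Z' × Σ (Emb Z Z') λ e →
    ∀ (X Y : LGraph) → 𝓕 X → 𝓕 Y → (f : Emb Z' X) (g : Emb Z' Y) →
      Σ LGraph λ W → 𝓕 W × Σ (Emb X W) λ f' → Σ (Emb Y W) λ g' →
        ∀ z → map f' (map f (map e z)) ≡ map g' (map g (map e z))

-- A forest admits a ranking: adjacent vertices get distinct ranks and every vertex has at most
-- one neighbour of smaller rank, so every tree is rooted at its unique vertex without such neighbour.
-- Join all roots of Z to a new hub through middle vertices and hang a pendant leaf on every
-- vertex of the resulting tree; the labels of the middle vertices and of the leaves can be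
-- chosen so that the label condition holds and every tree vertex has a neighbour labelled + 1
-- or + 2. This is Z′. Given embeddings of Z′ into X and Y in 𝒦, glue X and Y along the image of
-- the tree. The result is a forest because the tree is connected: a cycle through the Y-side
-- would leave in Y a nonempty set of vertices outside the tree, each with two neighbours in that
-- set or in the tree, which forces a cycle in Y. It satisfies the label condition because a
-- forbidden pair at a tree vertex c spread over both sides is completed on one side by the
-- neighbour of c labelled + 1 or + 2, which is present in X and in Y.

module Submission where

open import Defs
open import Data.Bool using (true; false) renaming (_≟_ to _≟ᵇ_)
open import Data.Empty using (⊥; ⊥-elim)
open import Data.Fin as Fin using (Fin; toℕ; fromℕ; fromℕ<; inject₁)
import Data.Fin.Properties as Fin
open import Data.Fin.Patterns using (0F; 1F; 2F; 3F; 4F)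
open import Data.Fin.Subset as Subset using (Subset; _∈_; _-_; ∣_∣)
open import Data.Fin.Subset.Properties using (_∈?_; nonempty?; ∈⊤; x∈p⇒∣p-x∣<∣p∣; x∈p∧x≢y⇒x∈p-y)
open import Data.List using (allFin)
open import Data.List.Membership.Propositional.Properties using (∈-allFin)
import Data.List.Relation.Unary.All as All
open import Data.Nat as ℕ using (ℕ; zero; suc; _+_; _≤_; _<_; z≤n; s≤s)
import Data.Nat.Properties as ℕ
open import Data.List.Extrema ℕ.≤-totalOrder using (argmax; f[xs]≤f[argmax])
open import Data.Nat.DivMod using (_%_; m<n⇒m%n≡m; n%n≡0)
open import Data.Product using (Σ; Σ-syntax; _×_; _,_; proj₁; proj₂)
open import Data.Sum as Sum using (_⊎_; inj₁; inj₂)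
open import Data.Sum.Function.Propositional using (_⊎-↔_)
open import Data.Sum.Properties using (inj₁-injective; inj₂-injective; ≡-dec)
open import Data.Unit using (⊤; tt)
open import Data.Vec.Functional using (updateAt)
open import Data.Vec.Functional.Properties using (updateAt-updates; updateAt-minimal)
open import Function using (_∘_)
open import Function.Bundles using (_↔_; Inverse; Injection; mk⇔)
open import Function.Properties.Inverse using (Inverse⇒Injection; ↔-trans)
open import Relation.Binary.PropositionalEquality
open import Relation.Nullary using (¬_; Dec; yes; no)
open import Relation.Nullary.Decidable
  using (does; _×-dec_; _⊎-dec_; ¬?; decidable-stable; ¬¬-excluded-middle; dec-true; dec-false; does-⇔)
open import Relation.Unary using (Decidable; _∪_)

-- Branching vertex sets and cycles

Adj : (G : LGraph) → Fin (size G) → Fin (size G) → Set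
Adj G u v = adj G u v ≡ true

Adj-sym : ∀ G {u v} → Adj G u v → Adj G v u
Adj-sym G {u} {v} e = trans (adj-sym G v u) e

Adj-irrefl : ∀ G {v} → ¬ Adj G v v
Adj-irrefl G {v} e with () ← trans (sym e) (adj-irrefl G v)

TwoNeighboursIn : (G : LGraph) → (Fin (size G) → Set) → Fin (size G) → Set
TwoNeighboursIn G M v =
  Σ[ a ∈ Fin (size G) ] Σ[ b ∈ Fin (size G) ] a ≢ b × Adj G v a × Adj G v b × M a × M b

module _ (G : LGraph) {M : Fin (size G) → Set} where

  TwoNeighboursIn-mono : ∀ {M′ v} → (∀ {a} → Adj G v a → M a → M′ a) →
                         TwoNeighboursIn G M v → TwoNeighboursIn G M′ v
  TwoNeighboursIn-mono M⊆M′ (a , b , a≢b , va , vb , Ma , Mb) =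
    a , b , a≢b , va , vb , M⊆M′ va Ma , M⊆M′ vb Mb

  TwoNeighboursIn-avoid : ∀ {v} → TwoNeighboursIn G M v → ∀ p →
                          Σ[ b ∈ Fin (size G) ] Adj G v b × M b × b ≢ p
  TwoNeighboursIn-avoid (a , b , a≢b , va , vb , Ma , Mb) p with a Fin.≟ p
  ... | yes refl = b , vb , Mb , a≢b ∘ sym
  ... | no a≢p   = a , va , Ma , a≢p

  twoNeighboursIn? : Decidable M → Decidable (TwoNeighboursIn G M)
  twoNeighboursIn? M? v = Fin.any? λ a → Fin.any? λ b →
    ¬? (a Fin.≟ b) ×-dec adj G v a ≟ᵇ true ×-dec adj G v b ≟ᵇ true ×-dec M? a ×-dec M? b

module _ (l : ℕ) where

  toℕ-nextC : ∀ t → toℕ (nextC l t) ≡ suc (toℕ t) % (3 + l)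
  toℕ-nextC t = trans (Fin.toℕ-fromℕ< _) (cong (_% (3 + l)) (ℕ.+-comm (toℕ t) 1))

  nextC-view : ∀ t → toℕ (nextC l t) ≡ suc (toℕ t) ⊎ (toℕ (nextC l t) ≡ 0 × toℕ t ≡ 2 + l)
  nextC-view t with ℕ.m<1+n⇒m<n∨m≡n (s≤s (Fin.toℕ<n t))
  ... | inj₁ t+1<L = inj₁ (trans (toℕ-nextC t) (m<n⇒m%n≡m t+1<L))
  ... | inj₂ t+1≡L =
    inj₂ (trans (toℕ-nextC t) (trans (cong (_% (3 + l)) t+1≡L) (n%n≡0 (3 + l))) , ℕ.suc-injective t+1≡L)

  prevC : Fin (3 + l) → Fin (3 + l)
  prevC Fin.zero    = fromℕ (2 + l)
  prevC (Fin.suc t) = inject₁ t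

  nextC-prevC : ∀ t → nextC l (prevC t) ≡ t
  nextC-prevC Fin.zero = Fin.toℕ-injective (begin
    toℕ (nextC l (fromℕ (2 + l)))       ≡⟨ toℕ-nextC (fromℕ (2 + l)) ⟩
    suc (toℕ (fromℕ (2 + l))) % (3 + l) ≡⟨ cong (λ n → suc n % (3 + l)) (Fin.toℕ-fromℕ (2 + l)) ⟩
    (3 + l) % (3 + l)                   ≡⟨ n%n≡0 (3 + l) ⟩
    0                                   ∎)
    where open ≡-Reasoning
  nextC-prevC (Fin.suc t) = Fin.toℕ-injective (begin
    toℕ (nextC l (inject₁ t))           ≡⟨ toℕ-nextC (inject₁ t) ⟩
    suc (toℕ (inject₁ t)) % (3 + l)     ≡⟨ cong (λ n → suc n % (3 + l)) (Fin.toℕ-inject₁ t) ⟩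
    suc (toℕ t) % (3 + l)               ≡⟨ m<n⇒m%n≡m (s≤s (Fin.toℕ<n t)) ⟩
    suc (toℕ t)                         ∎)
    where open ≡-Reasoning

  nextC≢prevC : ∀ t → nextC l t ≢ prevC t
  nextC≢prevC Fin.zero next≡prev with nextC-view Fin.zero
  ... | inj₁ next≡1 with () ← trans (sym next≡1) (trans (cong toℕ next≡prev) (Fin.toℕ-fromℕ (2 + l)))
  ... | inj₂ (_ , ())
  nextC≢prevC (Fin.suc t) next≡prev with nextC-view (Fin.suc t)
  ... | inj₁ next≡ = ℕ.m≢1+n+m (toℕ t) (trans (sym (Fin.toℕ-inject₁ t)) (trans (cong toℕ (sym next≡prev)) next≡))
  ... | inj₂ (next≡0 , t+1≡L)
    with () ← trans (sym next≡0) (trans (cong toℕ next≡prev) (trans (Fin.toℕ-inject₁ t) (ℕ.suc-injective t+1≡L)))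

OnCycle : ∀ {G} → Cycle G → Fin (size G) → Set
OnCycle C v = Σ[ t ∈ _ ] Cycle.verts C t ≡ v

module _ {G : LGraph} (C : Cycle G) where
  open Cycle C

  onCycle-twoNeighbours : ∀ {v} → OnCycle C v → TwoNeighboursIn G (OnCycle C) v
  onCycle-twoNeighbours (t , refl) =
    verts (nextC len-3 t) , verts (prevC len-3 t) , nextC≢prevC len-3 t ∘ distinct ,
    closed t , Adj-sym G prev~t , (_ , refl) , (_ , refl)
    where
    prev~t : Adj G (verts (prevC len-3 t)) (verts t)
    prev~t = subst (Adj G (verts (prevC len-3 t)) ∘ verts) (nextC-prevC len-3 t) (closed (prevC len-3 t))

closedPath⇒Cycle : (G : LGraph) (u : ℕ → Fin (size G)) (l : ℕ) →
                   (∀ {a b} → a ≤ 2 + l → b ≤ 2 + l → u a ≡ u b → a ≡ b) →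
                   (∀ k → Adj G (u k) (u (suc k))) → Adj G (u (2 + l)) (u 0) → Cycle G
closedPath⇒Cycle G u l u-inj u-step u-close = record
  { len-3 = l ; verts = u ∘ toℕ ; distinct = distinct ; closed = closed }
  where
  bound : (t : Fin (3 + l)) → toℕ t ≤ 2 + l
  bound t = ℕ.s≤s⁻¹ (Fin.toℕ<n t)

  distinct : ∀ {s t} → u (toℕ s) ≡ u (toℕ t) → s ≡ t
  distinct e = Fin.toℕ-injective (u-inj (bound _) (bound _) e)

  closed : ∀ t → Adj G (u (toℕ t)) (u (toℕ (nextC l t)))
  closed t with nextC-view l t
  ... | inj₁ next≡ rewrite next≡ = u-step (toℕ t)
  ... | inj₂ (next≡0 , t≡L) rewrite next≡0 | t≡L = u-close

module NonBacktrackingWalk (G : LGraph) (M : Fin (size G) → Set) {s t : Fin (size G)}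
  (s∈M : M s) (t∈M : M t) (s~t : Adj G s t)
  (branching : ∀ v → M v → v ≢ s → TwoNeighboursIn G M v) where

  record Step : Set where
    constructor step
    field
      from to : Fin (size G)
      from∈M : M from
      to∈M : M to
      edge : Adj G from to
  open Step

  onward : ∀ {v} → M v → v ≢ s → ∀ u → Σ[ x ∈ Fin (size G) ] Adj G v x × M x × x ≢ u
  onward v∈M v≢s = TwoNeighboursIn-avoid G (branching _ v∈M v≢s)

  next : Step → Step
  next (step u v u∈M v∈M u~v) with v Fin.≟ s
  ... | yes _   = step v u v∈M u∈M (Adj-sym G u~v)
  ... | no v≢s  = let (x , v~x , x∈M , _) = onward v∈M v≢s u in step v x v∈M x∈M v~x

  from-next : ∀ e → from (next e) ≡ to e
  from-next (step _ v _ _ _) with v Fin.≟ s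
  ... | yes _ = refl
  ... | no _  = refl

  next-nonbacktracking : ∀ e → to e ≢ s → to (next e) ≢ from e
  next-nonbacktracking (step u v _ v∈M _) v≢s with v Fin.≟ s
  ... | yes v≡s  = ⊥-elim (v≢s v≡s)
  ... | no v≢s′  = proj₂ (proj₂ (proj₂ (onward v∈M v≢s′ u)))

  walk : ℕ → Step
  walk zero    = step s t s∈M t∈M s~t
  walk (suc k) = next (walk k)

  w : ℕ → Fin (size G)
  w k = from (walk k)

  w-step : ∀ k → Adj G (w k) (w (suc k))
  w-step k = subst (Adj G (w k)) (sym (from-next (walk k))) (edge (walk k))

  w-nonbacktracking : ∀ k → w (suc k) ≢ s → w (suc (suc k)) ≢ w k
  w-nonbacktracking k w≢s
    rewrite from-next (next (walk k)) | from-next (walk k) = next-nonbacktracking (walk k) w≢s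

  InjectiveUpTo : ℕ → Set
  InjectiveUpTo j = ∀ {a b} → a ≤ j → b ≤ j → w a ≡ w b → a ≡ b

  revisit⇒Cycle : ∀ d i → InjectiveUpTo (d + i) → w (suc (d + i)) ≡ w i → Cycle G
  revisit⇒Cycle zero i _ w≡ = ⊥-elim (Adj-irrefl G (subst (Adj G (w i)) w≡ (w-step i)))
  revisit⇒Cycle (suc zero) i inj w≡ = ⊥-elim (w-nonbacktracking i w₁₊ᵢ≢s w≡)
    where
    w₁₊ᵢ≢s : w (suc i) ≢ s
    w₁₊ᵢ≢s e with () ← inj ℕ.≤-refl z≤n e
  revisit⇒Cycle (suc (suc l)) i inj w≡ = closedPath⇒Cycle G (λ k → w (k + i)) l
    (λ a≤ b≤ e → ℕ.+-cancelʳ-≡ i _ _ (inj (ℕ.+-monoˡ-≤ i a≤) (ℕ.+-monoˡ-≤ i b≤) e))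
    (λ k → w-step (k + i))
    (subst (Adj G _) w≡ (w-step (2 + l + i)))

  revisit : ∀ {i j} → InjectiveUpTo j → i ≤ j → w (suc j) ≡ w i → Cycle G
  revisit {i} inj i≤j w≡ with d , i+d≡j ← ℕ.m≤n⇒∃[o]m+o≡n i≤j
    with refl ← trans (ℕ.+-comm d i) i+d≡j = revisit⇒Cycle d i inj w≡

  injectiveUpTo-extend : ∀ {j} → InjectiveUpTo j → (∀ {i} → i ≤ j → w (suc j) ≢ w i) →
                         InjectiveUpTo (suc j)
  injectiveUpTo-extend inj fresh a≤ b≤ e with ℕ.m≤n⇒m<n∨m≡n a≤ | ℕ.m≤n⇒m<n∨m≡n b≤
  ... | inj₁ a<    | inj₁ b<    = inj (ℕ.s≤s⁻¹ a<) (ℕ.s≤s⁻¹ b<) e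
  ... | inj₂ refl  | inj₂ refl  = refl
  ... | inj₂ refl  | inj₁ b<    = ⊥-elim (fresh (ℕ.s≤s⁻¹ b<) e)
  ... | inj₁ a<    | inj₂ refl  = ⊥-elim (fresh (ℕ.s≤s⁻¹ a<) (sym e))

  injectiveUpTo-or-Cycle : ∀ j → InjectiveUpTo j ⊎ Cycle G
  injectiveUpTo-or-Cycle zero = inj₁ λ a≤0 b≤0 _ → trans (ℕ.n≤0⇒n≡0 a≤0) (sym (ℕ.n≤0⇒n≡0 b≤0))
  injectiveUpTo-or-Cycle (suc j) with injectiveUpTo-or-Cycle j
  ... | inj₂ C = inj₂ C
  ... | inj₁ inj with Fin.any? (λ (i : Fin (suc j)) → w (suc j) Fin.≟ w (toℕ i))
  ...   | no fresh = inj₁ (injectiveUpTo-extend inj λ {i} i≤j e →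
            fresh (fromℕ< (s≤s i≤j) , trans e (cong w (sym (Fin.toℕ-fromℕ< (s≤s i≤j))))))
  ...   | yes (i , w≡) = inj₂ (revisit inj (ℕ.s≤s⁻¹ (Fin.toℕ<n i)) w≡)

  cycle : Cycle G
  cycle with injectiveUpTo-or-Cycle (size G)
  ... | inj₂ C = C
  ... | inj₁ inj with Fin.pigeonhole (ℕ.n<1+n (size G)) (w ∘ toℕ)
  ...   | i , j , i<j , w≡ = ⊥-elim (ℕ.<⇒≢ i<j (inj (bound i) (bound j) w≡))
    where
    bound : (k : Fin (suc (size G))) → toℕ k ≤ size G
    bound k = ℕ.s≤s⁻¹ (Fin.toℕ<n k)

twoNeighboursExcept⇒Cycle : (G : LGraph) (M : Fin (size G) → Set) {s t : Fin (size G)} →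
  M s → M t → Adj G s t → (∀ v → M v → v ≢ s → TwoNeighboursIn G M v) → Cycle G
twoNeighboursExcept⇒Cycle G M s∈M t∈M s~t branching =
  NonBacktrackingWalk.cycle G M s∈M t∈M s~t branching

twoNeighbours⇒Cycle : (G : LGraph) (M : Fin (size G) → Set) {v : Fin (size G)} →
  M v → (∀ v → M v → TwoNeighboursIn G M v) → Cycle G
twoNeighbours⇒Cycle G M v∈M branching with branching _ v∈M
... | _ , _ , _ , v~a , _ , a∈M , _ =
  twoNeighboursExcept⇒Cycle G M v∈M a∈M v~a (λ u u∈M _ → branching u u∈M)

module _ {G H : LGraph} (e : Emb G H) where

  Adj-reflect : ∀ {x y} → Adj H (map e x) (map e y) → Adj G x y
  Adj-reflect {x} {y} = trans (sym (adj-pres e x y))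

  Adj-preserve : ∀ {x y} → Adj G x y → Adj H (map e x) (map e y)
  Adj-preserve {x} {y} = trans (adj-pres e x y)

  Cycle-pullback : (C : Cycle H) → (∀ t → Σ[ x ∈ Fin (size G) ] map e x ≡ Cycle.verts C t) → Cycle G
  Cycle-pullback C preimage = record
    { len-3 = len-3 ; verts = proj₁ ∘ preimage ; distinct = distinct′ ; closed = closed′ }
    where
    open Cycle C
    distinct′ : ∀ {s t} → proj₁ (preimage s) ≡ proj₁ (preimage t) → s ≡ t
    distinct′ {s} {t} eq = distinct (trans (sym (proj₂ (preimage s))) (trans (cong (map e) eq) (proj₂ (preimage t))))
    closed′ : ∀ t → Adj G (proj₁ (preimage t)) (proj₁ (preimage (nextC len-3 t)))
    closed′ t = Adj-reflect (subst₂ (Adj H) (sym (proj₂ (preimage t))) (sym (proj₂ (preimage _))) (closed t))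

  TwoNeighboursIn-reflect : ∀ {M v} → (∀ {a} → Adj H (map e v) a → Σ[ x ∈ Fin (size G) ] map e x ≡ a) →
                            TwoNeighboursIn H M (map e v) → TwoNeighboursIn G (M ∘ map e) v
  TwoNeighboursIn-reflect {M} closedNbhd (a , b , a≢b , va , vb , Ma , Mb)
    with x , refl ← closedNbhd va | y , refl ← closedNbhd vb =
    x , y , a≢b ∘ cong (map e) , Adj-reflect va , Adj-reflect vb , Ma , Mb

_∘ᴱ_ : ∀ {G H J} → Emb H J → Emb G H → Emb G J
e ∘ᴱ d = record
  { map        = map e ∘ map d
  ; inj        = inj d ∘ inj e
  ; adj-pres   = λ x y → trans (adj-pres e (map d x) (map d y)) (adj-pres d x y)
  ; label-pres = λ x → trans (label-pres e (map d x)) (label-pres d x) }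

-- Rankings

record IsRanking {V : Set} (E : V → V → Set) (r : V → ℕ) : Set where
  field
    separating  : ∀ {u v} → E u v → r u ≢ r v
    lowerUnique : ∀ {v a b} → E v a → E v b → r a < r v → r b < r v → a ≡ b

maximumAt : ∀ {n} (f : Fin n → ℕ) → Fin n → Σ[ t ∈ Fin n ] ∀ u → f u ≤ f t
maximumAt f d = argmax f d (allFin _) , λ u → All.lookup (f[xs]≤f[argmax] {f = f} d (allFin _)) (∈-allFin u)

ranking⇒acyclic : ∀ {G r} → IsRanking (Adj G) r → Acyclic G
ranking⇒acyclic {G} {r} R C = noLowerPair (onCycle-twoNeighbours C (top , refl))
  where
  open IsRanking R
  open Cycle C
  top : Fin (3 + len-3)
  top = proj₁ (maximumAt (r ∘ verts) Fin.zero)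

  top-maximal : ∀ u → r (verts u) ≤ r (verts top)
  top-maximal = proj₂ (maximumAt (r ∘ verts) Fin.zero)

  below : ∀ {a} → OnCycle C a → Adj G (verts top) a → r a < r (verts top)
  below (u , refl) top~a = ℕ.≤∧≢⇒< (top-maximal u) (separating top~a ∘ sym)

  noLowerPair : ¬ TwoNeighboursIn G (OnCycle C) (verts top)
  noLowerPair (a , b , a≢b , top~a , top~b , a∈C , b∈C) =
    a≢b (lowerUnique top~a top~b (below a∈C top~a) (below b∈C top~b))

Induced : ∀ {n} → Subset n → (Fin n → Fin n → Set) → Fin n → Fin n → Set
Induced S E u v = u ∈ S × v ∈ S × E u v

module _ (G : LGraph) (acyclic : Acyclic G) where

  RankingOn : Subset (size G) → Set
  RankingOn S = Σ[ r ∈ (Fin (size G) → ℕ) ] IsRanking (Induced S (Adj G)) r × (∀ {v} → v ∈ S → r v < ∣ S ∣)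

  -- Peel off a vertex with at most one neighbour in S and rank it above the rest;
  -- if there is none, S carries a cycle.
  rankingOn : ∀ k (S : Subset (size G)) → ∣ S ∣ < k → RankingOn S
  rankingOn (suc k) S S<k with Fin.any? (λ v → v ∈? S ×-dec ¬? (twoNeighboursIn? G (_∈? S) v))
  rankingOn (suc k) S S<k | no none with nonempty? S
  ... | yes (v , v∈S) = ⊥-elim (acyclic (twoNeighbours⇒Cycle G (_∈ S) v∈S branching))
    where
    branching : ∀ u → u ∈ S → TwoNeighboursIn G (_∈ S) u
    branching u u∈S = decidable-stable (twoNeighboursIn? G (_∈? S) u) λ ¬two → none (u , u∈S , ¬two)
  ... | no empty = (λ _ → 0) , ranking , λ v∈S → ⊥-elim (empty (_ , v∈S))
    where
    ranking : IsRanking (Induced S (Adj G)) (λ _ → 0)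
    ranking = record { separating  = λ (u∈S , _) → ⊥-elim (empty (_ , u∈S))
                     ; lowerUnique = λ (v∈S , _) → ⊥-elim (empty (_ , v∈S)) }
  rankingOn (suc k) S S<k | yes (v , v∈S , ¬two)
    with r′ , R′ , r′<m ← rankingOn k (S - v) (ℕ.<-≤-trans (x∈p⇒∣p-x∣<∣p∣ v∈S) (ℕ.s≤s⁻¹ S<k)) =
    r , ranking , bounded
    where
    open IsRanking R′ renaming (separating to separating′; lowerUnique to lowerUnique′)

    m : ℕ
    m = ∣ S - v ∣

    r : Fin (size G) → ℕ
    r = updateAt r′ v (λ _ → m)

    r-v : r v ≡ m
    r-v = updateAt-updates v r′

    r-other : ∀ {u} → u ≢ v → r u ≡ r′ u
    r-other {u} u≢v = updateAt-minimal u v r′ u≢v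

    S-v : ∀ {u} → u ∈ S → u ≢ v → u ∈ S - v
    S-v = x∈p∧x≢y⇒x∈p-y

    r-below : ∀ {u} → u ∈ S → u ≢ v → r u < m
    r-below u∈S u≢v = subst (_< m) (sym (r-other u≢v)) (r′<m (S-v u∈S u≢v))

    separating : ∀ {u w} → Induced S (Adj G) u w → r u ≢ r w
    separating {u} {w} (u∈S , w∈S , u~w) with u Fin.≟ v | w Fin.≟ v
    ... | yes refl | yes refl = ⊥-elim (Adj-irrefl G u~w)
    ... | yes refl | no w≢v   = λ e → ℕ.<⇒≢ (r-below w∈S w≢v) (trans (sym e) r-v)
    ... | no u≢v   | yes refl = λ e → ℕ.<⇒≢ (r-below u∈S u≢v) (trans e r-v)
    ... | no u≢v   | no w≢v   = λ e → separating′ (S-v u∈S u≢v , S-v w∈S w≢v , u~w)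
                                        (trans (sym (r-other u≢v)) (trans e (r-other w≢v)))

    lowerUnique : ∀ {x a b} → Induced S (Adj G) x a → Induced S (Adj G) x b →
                  r a < r x → r b < r x → a ≡ b
    lowerUnique {x} {a} {b} (x∈S , a∈S , x~a) (_ , b∈S , x~b) a<x b<x with x Fin.≟ v
    ... | yes refl = decidable-stable (a Fin.≟ b) λ a≢b → ¬two (a , b , a≢b , x~a , x~b , a∈S , b∈S)
    ... | no x≢v with a Fin.≟ v | b Fin.≟ v
    ...   | yes refl | _ = ⊥-elim (ℕ.<-asym a<x (subst (r x <_) (sym r-v) (r-below x∈S x≢v)))
    ...   | no _ | yes refl = ⊥-elim (ℕ.<-asym b<x (subst (r x <_) (sym r-v) (r-below x∈S x≢v)))
    ...   | no a≢v | no b≢v = lowerUnique′ (S-v x∈S x≢v , S-v a∈S a≢v , x~a) (S-v x∈S x≢v , S-v b∈S b≢v , x~b)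
                                (subst₂ _<_ (r-other a≢v) (r-other x≢v) a<x) (subst₂ _<_ (r-other b≢v) (r-other x≢v) b<x)

    ranking : IsRanking (Induced S (Adj G)) r
    ranking = record { separating = separating ; lowerUnique = lowerUnique }

    bounded : ∀ {u} → u ∈ S → r u < ∣ S ∣
    bounded {u} u∈S with u Fin.≟ v
    ... | yes refl = subst (_< ∣ S ∣) (sym r-v) (x∈p⇒∣p-x∣<∣p∣ v∈S)
    ... | no u≢v   = ℕ.<-trans (r-below u∈S u≢v) (x∈p⇒∣p-x∣<∣p∣ v∈S)

  acyclic⇒ranking : Σ[ r ∈ (Fin (size G) → ℕ) ] IsRanking (Adj G) r
  acyclic⇒ranking with r , R , _ ← rankingOn _ Subset.⊤ (ℕ.n<1+n _) = r , record
    { separating  = λ u~v → separating (∈⊤ , ∈⊤ , u~v)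
    ; lowerUnique = λ v~a v~b → lowerUnique (∈⊤ , ∈⊤ , v~a) (∈⊤ , ∈⊤ , v~b) }
    where open IsRanking R

-- Rooted cores

record RootedCore (G : LGraph) : Set₁ where
  field
    Core      : Fin (size G) → Set
    Core?     : Decidable Core
    level     : Fin (size G) → ℕ
    root      : Fin (size G)
    Core-root : Core root
    descend   : ∀ {v} → Core v → v ≢ root →
                Σ[ u ∈ Fin (size G) ] Core u × Adj G v u × level u < level v

RootedCore-image : ∀ {G H} → Emb G H → RootedCore G → RootedCore H
RootedCore-image {G} {H} e K = record
  { Core = Image ; Core? = image? ; level = level′ ; root = map e root
  ; Core-root = root , Core-root , refl ; descend = descend′ }
  where
  open RootedCore K

  Image : Fin (size H) → Set
  Image v = Σ[ c ∈ Fin (size G) ] Core c × map e c ≡ v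

  image? : Decidable Image
  image? v = Fin.any? λ c → Core? c ×-dec map e c Fin.≟ v

  level′ : Fin (size H) → ℕ
  level′ v with image? v
  ... | yes (c , _) = level c
  ... | no _        = 0

  level′-image : ∀ {c} → Core c → level′ (map e c) ≡ level c
  level′-image {c} c∈C with image? (map e c)
  ... | yes (c′ , _ , ec′≡ec) = cong level (inj e ec′≡ec)
  ... | no ∉image = ⊥-elim (∉image (c , c∈C , refl))

  descend′ : ∀ {v} → Image v → v ≢ map e root → Σ[ u ∈ Fin (size H) ] Image u × Adj H v u × level′ u < level′ v
  descend′ (c , c∈C , refl) ec≢root with u , u∈C , c~u , u<c ← descend c∈C (ec≢root ∘ cong (map e)) =
    map e u , (u , u∈C , refl) , Adj-preserve e c~u , subst₂ _<_ (sym (level′-image u∈C)) (sym (level′-image c∈C)) u<c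

module _ {G : LGraph} (acyclic : Acyclic G) (K : RootedCore G) where
  open RootedCore K

  NoTwoNeighbourSetBeside : (Fin (size G) → Set) → Set₁
  NoTwoNeighbourSetBeside C = ∀ (T : Fin (size G) → Set) {t} → T t → (∀ {v} → T v → ¬ C v) →
                              (∀ {v} → T v → TwoNeighboursIn G (T ∪ C) v) → ⊥

  Below : ℕ → Fin (size G) → Set
  Below k v = v ≡ root ⊎ (Core v × level v < k)

  below? : ∀ k → Decidable (Below k)
  below? k v = (v Fin.≟ root) ⊎-dec (Core? v ×-dec level v ℕ.<? k)

  Below-suc : ∀ {k v} → Below k v → Below (suc k) v
  Below-suc (inj₁ v≡root)       = inj₁ v≡root
  Below-suc (inj₂ (v∈C , v<k))  = inj₂ (v∈C , ℕ.m<n⇒m<1+n v<k)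

  noTwoNeighbourSetBeside-root : NoTwoNeighbourSetBeside (Below 0)
  noTwoNeighbourSetBeside-root T {t} t∈T disjoint branching = ¬¬-excluded-middle split
    where
    inT : ∀ {v} → (T ∪ Below 0) v → v ≢ root → T v
    inT (inj₁ v∈T)        _      = v∈T
    inT (inj₂ (inj₁ refl)) v≢root = ⊥-elim (v≢root refl)
    stayInT : ¬ (Σ[ s ∈ _ ] T s × Adj G root s) → ∀ {v a} → T v → Adj G v a → (T ∪ Below 0) a → T a
    stayInT _        _   _   (inj₁ a∈T)         = a∈T
    stayInT detached v∈T v~a (inj₂ (inj₁ refl)) = ⊥-elim (detached (_ , v∈T , Adj-sym G v~a))
    split : Dec (Σ[ s ∈ _ ] T s × Adj G root s) → ⊥
    split (yes (s , s∈T , root~s)) = acyclic (twoNeighboursExcept⇒Cycle G (T ∪ Below 0) (inj₂ (inj₁ refl)) (inj₁ s∈T) root~s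
      λ v v∈M v≢root → branching (inT v∈M v≢root))
    split (no detached) = acyclic (twoNeighbours⇒Cycle G T t∈T λ v v∈T →
      TwoNeighboursIn-mono G (stayInT detached v∈T) (branching v∈T))

  -- Vertices of level k that touch T move from the core side over to T.
  noTwoNeighbourSetBeside-suc : ∀ {k} → NoTwoNeighbourSetBeside (Below k) → NoTwoNeighbourSetBeside (Below (suc k))
  noTwoNeighbourSetBeside-suc {k} IH T t∈T disjoint branching = IH T′ (inj₁ t∈T) disjoint′ branching′
    where
    Attached : Fin (size G) → Set
    Attached v = Below (suc k) v × ¬ Below k v × Σ[ t ∈ Fin (size G) ] T t × Adj G v t

    T′ : Fin (size G) → Set
    T′ = T ∪ Attached

    disjoint′ : ∀ {v} → T′ v → ¬ Below k v
    disjoint′ (inj₁ v∈T)             = disjoint v∈T ∘ Below-suc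
    disjoint′ (inj₂ (_ , v∉Bk , _))  = v∉Bk

    absorb : ∀ {v a} → T v → Adj G v a → (T ∪ Below (suc k)) a → (T′ ∪ Below k) a
    absorb _   _   (inj₁ a∈T) = inj₁ (inj₁ a∈T)
    absorb {v} {a} v∈T v~a (inj₂ a∈B) with below? k a
    ... | yes a∈Bk = inj₂ a∈Bk
    ... | no a∉Bk  = inj₁ (inj₂ (a∈B , a∉Bk , v , v∈T , Adj-sym G v~a))

    branching′ : ∀ {v} → T′ v → TwoNeighboursIn G (T′ ∪ Below k) v
    branching′ (inj₁ v∈T) = TwoNeighboursIn-mono G (absorb v∈T) (branching v∈T)
    branching′ (inj₂ (inj₁ refl , v∉Bk , _)) = ⊥-elim (v∉Bk (inj₁ refl))
    branching′ (inj₂ (inj₂ (v∈C , v≤k) , v∉Bk , t , t∈T , v~t))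
      with u , u∈C , v~u , u<v ← descend v∈C (v∉Bk ∘ inj₁) =
      t , u , t≢u , v~t , v~u , inj₁ (inj₁ t∈T) , inj₂ u∈Bk
      where
      u∈Bk : Below k u
      u∈Bk = inj₂ (u∈C , ℕ.<-≤-trans u<v (ℕ.s≤s⁻¹ v≤k))
      t≢u : t ≢ u
      t≢u refl = disjoint t∈T (Below-suc u∈Bk)

  noTwoNeighbourSetBeside-below : ∀ k → NoTwoNeighbourSetBeside (Below k)
  noTwoNeighbourSetBeside-below zero    = noTwoNeighbourSetBeside-root
  noTwoNeighbourSetBeside-below (suc k) = noTwoNeighbourSetBeside-suc (noTwoNeighbourSetBeside-below k)

  noTwoNeighbourSetBeside-core : NoTwoNeighbourSetBeside Core
  noTwoNeighbourSetBeside-core T t∈T disjoint branching =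
    noTwoNeighbourSetBeside-below (suc (level top)) T t∈T
      (λ v∈T → disjoint v∈T ∘ Below⇒Core) (TwoNeighboursIn-mono G (λ _ → Sum.map₂ Core⇒Below) ∘ branching)
    where
    top : Fin (size G)
    top = proj₁ (maximumAt level root)
    Core⇒Below : ∀ {v} → Core v → Below (suc (level top)) v
    Core⇒Below {v} v∈C = inj₂ (v∈C , s≤s (proj₂ (maximumAt level root) v))
    Below⇒Core : ∀ {v} → Below (suc (level top)) v → Core v
    Below⇒Core (inj₁ refl)      = Core-root
    Below⇒Core (inj₂ (v∈C , _)) = v∈C

-- Labelled graphs on finite types

NoBadPair : ∀ {V : Set} → (V → V → Set) → (V → ℤ₅) → Set
NoBadPair E ℓ = ∀ u v w → E u v → E u w → ℓ v ≡ ℓ u +₅ 1 → ℓ w ≡ ℓ u +₅ 2 → ⊥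

does⇒ : ∀ {A : Set} (a? : Dec A) → does a? ≡ true → A
does⇒ (yes a) _ = a

does-reflects : ∀ {A : Set} (a? : Dec A) {b} → (A → b ≡ true) → (b ≡ true → A) → does a? ≡ b
does-reflects (yes a) A⇒b _ = sym (A⇒b a)
does-reflects (no ¬a) {false} _ _ = refl
does-reflects (no ¬a) {true} _ b⇒A = ⊥-elim (¬a (b⇒A refl))

record GraphOn (V : Set) : Set₁ where
  field
    _~_      : V → V → Set
    _~?_     : ∀ u v → Dec (u ~ v)
    ~-sym    : ∀ {u v} → u ~ v → v ~ u
    ~-irrefl : ∀ {v} → ¬ v ~ v
    colour   : V → ℤ₅

module Realise {V : Set} {m : ℕ} (enum : Fin m ↔ V) (Γ : GraphOn V) where
  open GraphOn Γ
  open Inverse enum using (to; from)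

  to-from : ∀ v → to (from v) ≡ v
  to-from = Inverse.strictlyInverseˡ enum

  from-to : ∀ i → from (to i) ≡ i
  from-to = Inverse.strictlyInverseʳ enum

  to-injective : ∀ {i j} → to i ≡ to j → i ≡ j
  to-injective = Injection.injective (Inverse⇒Injection enum)

  graph : LGraph
  graph = record
    { size       = m
    ; adj        = λ i j → does (to i ~? to j)
    ; label      = colour ∘ to
    ; adj-sym    = λ i j → does-⇔ (mk⇔ ~-sym ~-sym) (to i ~? to j) (to j ~? to i)
    ; adj-irrefl = λ i → dec-false (to i ~? to i) ~-irrefl
    }

  Adj⇒~ : ∀ {i j} → Adj graph i j → to i ~ to j
  Adj⇒~ {i} {j} = does⇒ (to i ~? to j)

  ~⇒Adj : ∀ {i j} → to i ~ to j → Adj graph i j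
  ~⇒Adj {i} {j} = dec-true (to i ~? to j)

  ~⇒Adj-from : ∀ {u v} → u ~ v → Adj graph (from u) (from v)
  ~⇒Adj-from {u} {v} = ~⇒Adj ∘ subst₂ _~_ (sym (to-from u)) (sym (to-from v))

  label-from : ∀ v → label graph (from v) ≡ colour v
  label-from v = cong colour (to-from v)

  ranking : ∀ {r} → IsRanking _~_ r → IsRanking (Adj graph) (r ∘ to)
  ranking R = record
    { separating  = separating ∘ Adj⇒~
    ; lowerUnique = λ v~a v~b a<v b<v → to-injective (lowerUnique (Adj⇒~ v~a) (Adj⇒~ v~b) a<v b<v) }
    where open IsRanking R

  labelCond : NoBadPair _~_ colour → LabelCond graph
  labelCond noBad u v w u~v u~w = noBad (to u) (to v) (to w) (Adj⇒~ u~v) (Adj⇒~ u~w)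

  rootedCore : (rk : V → ℕ) (h : V) → (∀ {v} → v ≢ h → Σ[ u ∈ V ] v ~ u × rk u < rk v) → RootedCore graph
  rootedCore rk h descendᵥ = record
    { Core = λ _ → ⊤ ; Core? = λ _ → yes tt ; level = rk ∘ to ; root = from h ; Core-root = tt
    ; descend = descend′ }
    where
    descend′ : ∀ {i} → ⊤ → i ≢ from h → Σ[ j ∈ Fin m ] ⊤ × Adj graph i j × rk (to j) < rk (to i)
    descend′ {i} _ i≢h with u , i~u , u<i ← descendᵥ (λ i≡h → i≢h (trans (sym (from-to i)) (cong from i≡h))) =
      from u , tt , ~⇒Adj (subst (to i ~_) (sym (to-from u)) i~u) , subst (λ w → rk w < rk (to i)) (sym (to-from u)) u<i

  embedding : (H : LGraph) (φ : Fin (size H) → V) → (∀ {x y} → φ x ≡ φ y → x ≡ y) →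
              (∀ {x y} → φ x ~ φ y → Adj H x y) → (∀ {x y} → Adj H x y → φ x ~ φ y) →
              (∀ x → colour (φ x) ≡ label H x) → Emb H graph
  embedding H φ φ-inj φ-reflect φ-preserve φ-colour = record
    { map        = from ∘ φ
    ; inj        = λ {x} {y} e → φ-inj (trans (sym (to-from (φ x))) (trans (cong to e) (to-from (φ y))))
    ; adj-pres   = λ x y → subst₂ (λ a b → does (a ~? b) ≡ adj H x y) (sym (to-from (φ x))) (sym (to-from (φ y)))
                             (does-reflects (φ x ~? φ y) φ-reflect φ-preserve)
    ; label-pres = λ x → trans (label-from (φ x)) (φ-colour x)
    }

+₅1≢+₅2 : ∀ x → x +₅ 1 ≢ x +₅ 2
+₅1≢+₅2 0F ()
+₅1≢+₅2 1F ()
+₅1≢+₅2 2F ()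
+₅1≢+₅2 3F ()
+₅1≢+₅2 4F ()

CommittedAt : (G : LGraph) → Fin (size G) → Set
CommittedAt G c = Σ[ ℓ ∈ Fin (size G) ] Adj G c ℓ × (label G ℓ ≡ label G c +₅ 1 ⊎ label G ℓ ≡ label G c +₅ 2)

Committed : (G : LGraph) → (Fin (size G) → Set) → Set
Committed G C = ∀ {c} → C c → CommittedAt G c

-- The extension Z′

module WithLeaves (G : LGraph) where

  V : Set
  V = Fin (size G) ⊎ Fin (size G)

  data _~_ : V → V → Set where
    old~old  : ∀ {u v} → Adj G u v → inj₁ u ~ inj₁ v
    old~leaf : ∀ {v} → inj₁ v ~ inj₂ v
    leaf~old : ∀ {v} → inj₂ v ~ inj₁ v

  _~?_ : ∀ u v → Dec (u ~ v)
  inj₁ u ~? inj₁ v with adj G u v ≟ᵇ true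
  ... | yes u~v = yes (old~old u~v)
  ... | no ¬u~v = no λ { (old~old u~v) → ¬u~v u~v }
  inj₁ u ~? inj₂ v with u Fin.≟ v
  ... | yes refl = yes old~leaf
  ... | no u≢v   = no λ { old~leaf → u≢v refl }
  inj₂ u ~? inj₁ v with u Fin.≟ v
  ... | yes refl = yes leaf~old
  ... | no u≢v   = no λ { leaf~old → u≢v refl }
  inj₂ u ~? inj₂ v = no λ ()

  HasNeighbour+₅2 : Fin (size G) → Set
  HasNeighbour+₅2 c = Σ[ b ∈ Fin (size G) ] Adj G c b × label G b ≡ label G c +₅ 2

  hasNeighbour+₅2? : Decidable HasNeighbour+₅2
  hasNeighbour+₅2? c = Fin.any? λ b → adj G c b ≟ᵇ true ×-dec label G b Fin.≟ label G c +₅ 2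

  -- The leaf of c is labelled c + 2 exactly when c already sees that label, so that
  -- the leaf never completes a forbidden pair.
  leafColour : Fin (size G) → ℤ₅
  leafColour c with hasNeighbour+₅2? c
  ... | yes _ = label G c +₅ 2
  ... | no _  = label G c +₅ 1

  leafColour-cases : ∀ c → (HasNeighbour+₅2 c × leafColour c ≡ label G c +₅ 2) ⊎
                           (¬ HasNeighbour+₅2 c × leafColour c ≡ label G c +₅ 1)
  leafColour-cases c with hasNeighbour+₅2? c
  ... | yes has = inj₁ (has , refl)
  ... | no ¬has = inj₂ (¬has , refl)

  colour : V → ℤ₅
  colour (inj₁ v) = label G v
  colour (inj₂ v) = leafColour v

  graphOn : GraphOn V
  graphOn = record
    { _~_ = _~_ ; _~?_ = _~?_ ; colour = colour
    ; ~-sym = λ { (old~old u~v) → old~old (Adj-sym G u~v) ; old~leaf → leaf~old ; leaf~old → old~leaf }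
    ; ~-irrefl = λ { (old~old v~v) → Adj-irrefl G v~v } }

  noBadPair : LabelCond G → NoBadPair _~_ colour
  noBadPair lc (inj₁ c) (inj₁ a) (inj₁ b) (old~old c~a) (old~old c~b) a+1 b+2 = lc c a b c~a c~b a+1 b+2
  noBadPair lc (inj₁ c) (inj₁ a) (inj₂ c) (old~old c~a) old~leaf a+1 ℓ+2 with leafColour-cases c
  ... | inj₁ ((b , c~b , b+2) , _) = lc c a b c~a c~b a+1 b+2
  ... | inj₂ (_ , ℓ+1)             = +₅1≢+₅2 (label G c) (trans (sym ℓ+1) ℓ+2)
  noBadPair lc (inj₁ c) (inj₂ c) (inj₁ b) old~leaf (old~old c~b) ℓ+1 b+2 with leafColour-cases c
  ... | inj₁ (_ , ℓ+2)   = +₅1≢+₅2 (label G c) (trans (sym ℓ+1) ℓ+2)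
  ... | inj₂ (¬has , _) = ¬has (b , c~b , b+2)
  noBadPair lc (inj₁ c) (inj₂ c) (inj₂ c) old~leaf old~leaf ℓ+1 ℓ+2 = +₅1≢+₅2 (label G c) (trans (sym ℓ+1) ℓ+2)
  noBadPair lc (inj₂ c) (inj₁ c) (inj₁ c) leaf~old leaf~old c+1 c+2 = +₅1≢+₅2 (leafColour c) (trans (sym c+1) c+2)

  rank : (Fin (size G) → ℕ) → V → ℕ
  rank r (inj₁ v) = r v
  rank r (inj₂ v) = suc (r v)

  ranking : ∀ {r} → IsRanking (Adj G) r → IsRanking _~_ (rank r)
  ranking {r} R = record { separating = separating′ ; lowerUnique = lowerUnique′ }
    where
    open IsRanking R
    separating′ : ∀ {u v} → u ~ v → rank r u ≢ rank r v
    separating′ (old~old u~v) = separating u~v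
    separating′ old~leaf      = ℕ.1+n≢n ∘ sym
    separating′ leaf~old      = ℕ.1+n≢n
    lowerUnique′ : ∀ {v a b} → v ~ a → v ~ b → rank r a < rank r v → rank r b < rank r v → a ≡ b
    lowerUnique′ (old~old v~a) (old~old v~b) a<v b<v = cong inj₁ (lowerUnique v~a v~b a<v b<v)
    lowerUnique′ old~leaf _ ℓ<v _ = ⊥-elim (ℕ.<-asym ℓ<v (ℕ.n<1+n _))
    lowerUnique′ _ old~leaf _ ℓ<v = ⊥-elim (ℕ.<-asym ℓ<v (ℕ.n<1+n _))
    lowerUnique′ leaf~old leaf~old _ _ = refl

  graph : LGraph
  graph = Realise.graph Fin.+↔⊎ graphOn

  open Realise Fin.+↔⊎ graphOn using (~⇒Adj-from; label-from; labelCond)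
    renaming (embedding to embedInto; ranking to realiseRanking)

  embedding : Emb G graph
  embedding = embedInto G inj₁ (λ { refl → refl }) (λ { (old~old u~v) → u~v }) old~old (λ _ → refl)

  committed : ∀ c → CommittedAt graph (map embedding c)
  committed c = Inverse.from Fin.+↔⊎ (inj₂ c) , ~⇒Adj-from old~leaf ,
                Sum.map (relabel 1) (relabel 2) (Sum.swap (Sum.map proj₂ proj₂ (leafColour-cases c)))
    where
    relabel : ∀ k → leafColour c ≡ label G c +₅ k →
              label graph (Inverse.from Fin.+↔⊎ (inj₂ c)) ≡ label graph (map embedding c) +₅ k
    relabel k e = trans (label-from (inj₂ c)) (trans e (cong (_+₅ k) (sym (label-from (inj₁ c)))))

  inK : InK G → InK graph
  inK (acyclic , lc) =
    ranking⇒acyclic (realiseRanking (ranking (proj₂ (acyclic⇒ranking G acyclic)))) , labelCond (noBadPair lc)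

-- On the path hub (label 0) — mid z (label midColour i) — old z (label i) no vertex sees both its
-- label + 1 and its label + 2, and midColour i ≠ 2 because the hub sees every middle vertex.
midColour : ℤ₅ → ℤ₅
midColour 0F = 3F
midColour 1F = 0F
midColour 2F = 0F
midColour 3F = 1F
midColour 4F = 4F

midColour≢+₅1 : ∀ i → midColour i ≢ i +₅ 1
midColour≢+₅1 0F ()
midColour≢+₅1 1F ()
midColour≢+₅1 2F ()
midColour≢+₅1 3F ()
midColour≢+₅1 4F ()

midColour≢+₅2 : ∀ i → midColour i ≢ i +₅ 2
midColour≢+₅2 0F ()
midColour≢+₅2 1F ()
midColour≢+₅2 2F ()
midColour≢+₅2 3F ()
midColour≢+₅2 4F ()

midColour≢2 : ∀ i → midColour i ≢ 0F +₅ 2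
midColour≢2 0F ()
midColour≢2 1F ()
midColour≢2 2F ()
midColour≢2 3F ()
midColour≢2 4F ()

midColour-hub-old : ∀ i → 0F ≡ midColour i +₅ 1 → i ≡ midColour i +₅ 2 → ⊥
midColour-hub-old 0F () _
midColour-hub-old 1F () _
midColour-hub-old 2F () _
midColour-hub-old 3F () _
midColour-hub-old 4F _ ()

midColour-old-hub : ∀ i → i ≡ midColour i +₅ 1 → 0F ≡ midColour i +₅ 2 → ⊥
midColour-old-hub 0F () _
midColour-old-hub 1F _ ()
midColour-old-hub 2F () _
midColour-old-hub 3F () _
midColour-old-hub 4F () _

pattern hub   = inj₁ tt
pattern old z = inj₂ (inj₁ z)
pattern mid z = inj₂ (inj₂ z)

module Spine (Z : LGraph) {r : Fin (size Z) → ℕ} (R : IsRanking (Adj Z) r) where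

  V : Set
  V = ⊤ ⊎ (Fin (size Z) ⊎ Fin (size Z))

  enum : Fin (suc (size Z + size Z)) ↔ V
  enum = ↔-trans (Fin.+↔⊎ {1}) (Fin.1↔⊤ ⊎-↔ Fin.+↔⊎)

  LowerNeighbour : Fin (size Z) → Set
  LowerNeighbour z = Σ[ y ∈ Fin (size Z) ] Adj Z z y × r y < r z

  lowerNeighbour? : Decidable LowerNeighbour
  lowerNeighbour? z = Fin.any? λ y → adj Z z y ≟ᵇ true ×-dec r y ℕ.<? r z

  IsRoot : Fin (size Z) → Set
  IsRoot z = ¬ LowerNeighbour z

  data _~_ : V → V → Set where
    old~old : ∀ {y z} → Adj Z y z → old y ~ old z
    hub~mid : ∀ {z} → hub ~ mid z
    mid~hub : ∀ {z} → mid z ~ hub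
    old~mid : ∀ {z} → IsRoot z → old z ~ mid z
    mid~old : ∀ {z} → IsRoot z → mid z ~ old z

  _~?_ : ∀ u v → Dec (u ~ v)
  hub   ~? hub   = no λ ()
  hub   ~? old _ = no λ ()
  hub   ~? mid _ = yes hub~mid
  old y ~? hub   = no λ ()
  old y ~? old z with adj Z y z ≟ᵇ true
  ... | yes y~z = yes (old~old y~z)
  ... | no ¬y~z = no λ { (old~old y~z) → ¬y~z y~z }
  old y ~? mid z with y Fin.≟ z | lowerNeighbour? y
  ... | yes refl | no isRoot = yes (old~mid isRoot)
  ... | yes refl | yes lower = no λ { (old~mid isRoot) → isRoot lower }
  ... | no y≢z   | _         = no λ { (old~mid _) → y≢z refl }
  mid _ ~? hub   = yes mid~hub
  mid y ~? old z with y Fin.≟ z | lowerNeighbour? y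
  ... | yes refl | no isRoot = yes (mid~old isRoot)
  ... | yes refl | yes lower = no λ { (mid~old isRoot) → isRoot lower }
  ... | no y≢z   | _         = no λ { (mid~old _) → y≢z refl }
  mid _ ~? mid _ = no λ ()

  colour : V → ℤ₅
  colour hub     = 0F
  colour (old z) = label Z z
  colour (mid z) = midColour (label Z z)

  graphOn : GraphOn V
  graphOn = record
    { _~_ = _~_ ; _~?_ = _~?_ ; colour = colour
    ; ~-sym = λ { (old~old y~z) → old~old (Adj-sym Z y~z) ; hub~mid → mid~hub ; mid~hub → hub~mid
                ; (old~mid isRoot) → mid~old isRoot ; (mid~old isRoot) → old~mid isRoot }
    ; ~-irrefl = λ { (old~old z~z) → Adj-irrefl Z z~z } }

  noBadPair : LabelCond Z → NoBadPair _~_ colour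
  noBadPair lc hub     (mid _) (mid b) hub~mid hub~mid _ b+2 = midColour≢2 (label Z b) b+2
  noBadPair lc (old z) (old a) (old b) (old~old z~a) (old~old z~b) a+1 b+2 = lc z a b z~a z~b a+1 b+2
  noBadPair lc (old z) (mid z) _ (old~mid _) _ m+1 _ = midColour≢+₅1 (label Z z) m+1
  noBadPair lc (old z) (old _) (mid z) _ (old~mid _) _ m+2 = midColour≢+₅2 (label Z z) m+2
  noBadPair lc (mid z) hub hub mid~hub mid~hub 0+1 0+2 = +₅1≢+₅2 (midColour (label Z z)) (trans (sym 0+1) 0+2)
  noBadPair lc (mid z) hub (old z) mid~hub (mid~old _) 0+1 i+2 = midColour-hub-old (label Z z) 0+1 i+2
  noBadPair lc (mid z) (old z) hub (mid~old _) mid~hub i+1 0+2 = midColour-old-hub (label Z z) i+1 0+2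
  noBadPair lc (mid z) (old z) (old z) (mid~old _) (mid~old _) i+1 i+2 =
    +₅1≢+₅2 (midColour (label Z z)) (trans (sym i+1) i+2)

  rank : V → ℕ
  rank hub     = 0
  rank (mid _) = 1
  rank (old z) = 2 + r z

  ranking : IsRanking _~_ rank
  ranking = record { separating = separating′ ; lowerUnique = lowerUnique′ }
    where
    open IsRanking R
    separating′ : ∀ {u v} → u ~ v → rank u ≢ rank v
    separating′ (old~old y~z) = separating y~z ∘ ℕ.suc-injective ∘ ℕ.suc-injective
    separating′ hub~mid       = λ ()
    separating′ mid~hub       = λ ()
    separating′ (old~mid _)   = λ ()
    separating′ (mid~old _)   = λ ()
    lowerUnique′ : ∀ {v a b} → v ~ a → v ~ b → rank a < rank v → rank b < rank v → a ≡ b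
    lowerUnique′ (old~old z~a) (old~old z~b) a<z b<z =
      cong old (lowerUnique z~a z~b (ℕ.s≤s⁻¹ (ℕ.s≤s⁻¹ a<z)) (ℕ.s≤s⁻¹ (ℕ.s≤s⁻¹ b<z)))
    lowerUnique′ (old~old z~a) (old~mid isRoot) a<z _ = ⊥-elim (isRoot (_ , z~a , ℕ.s≤s⁻¹ (ℕ.s≤s⁻¹ a<z)))
    lowerUnique′ (old~mid isRoot) (old~old z~b) _ b<z = ⊥-elim (isRoot (_ , z~b , ℕ.s≤s⁻¹ (ℕ.s≤s⁻¹ b<z)))
    lowerUnique′ (old~mid _) (old~mid _) _ _ = refl
    lowerUnique′ mid~hub mid~hub _ _ = refl
    lowerUnique′ mid~hub (mid~old _) _ (s≤s ())
    lowerUnique′ (mid~old _) _ (s≤s ()) _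

  descend : ∀ {v} → v ≢ hub → Σ[ u ∈ V ] v ~ u × rank u < rank v
  descend {hub}   hub≢hub = ⊥-elim (hub≢hub refl)
  descend {mid z} _       = hub , mid~hub , s≤s z≤n
  descend {old z} _ with lowerNeighbour? z
  ... | yes (y , z~y , y<z) = old y , old~old z~y , s≤s (s≤s y<z)
  ... | no isRoot           = mid z , old~mid isRoot , s≤s (s≤s z≤n)

  open Realise enum graphOn public using (graph)
  open Realise enum graphOn using (rootedCore; labelCond) renaming (embedding to embedInto; ranking to realiseRanking)

  core : RootedCore graph
  core = rootedCore rank hub descend

  inK : LabelCond Z → InK graph
  inK lc = ranking⇒acyclic (realiseRanking ranking) , labelCond (noBadPair lc)

  embedding : Emb Z graph
  embedding = embedInto Z old (λ { refl → refl }) (λ { (old~old y~z) → y~z }) old~old (λ _ → refl)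

-- Amalgamation over a committed rooted core

module Amalgamation {Z X Y : LGraph} (K : RootedCore Z) (committed : Committed Z (RootedCore.Core K))
                    (f : Emb Z X) (g : Emb Z Y) where
  open RootedCore K
  module KY = RootedCore (RootedCore-image g K)

  V : Set
  V = Fin (size X) ⊎ Fin (size Y)

  -- The glued graph lives on X ⊎ Y: a core vertex of Y is represented by its copy in X,
  -- and its own slot inj₂ y stays isolated.
  fromY : Fin (size Y) → V
  fromY y with KY.Core? y
  ... | yes (c , _) = inj₁ (map f c)
  ... | no _        = inj₂ y

  fromY-core : ∀ {c} → Core c → fromY (map g c) ≡ inj₁ (map f c)
  fromY-core {c} c∈C with KY.Core? (map g c)
  ... | yes (c′ , _ , gc′≡gc) = cong (inj₁ ∘ map f) (inj g gc′≡gc)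
  ... | no ∉core = ⊥-elim (∉core (c , c∈C , refl))

  fromY≡inj₁ : ∀ {x y} → fromY y ≡ inj₁ x → Σ[ c ∈ Fin (size Z) ] Core c × map f c ≡ x × map g c ≡ y
  fromY≡inj₁ {x} {y} eq with KY.Core? y
  ... | yes (c , c∈C , refl) = c , c∈C , inj₁-injective eq , refl

  fromY-injective : ∀ {y y′} → fromY y ≡ fromY y′ → y ≡ y′
  fromY-injective {y} {y′} eq with KY.Core? y | KY.Core? y′
  ... | yes (_ , _ , refl) | yes (_ , _ , refl) = cong (map g) (inj f (inj₁-injective eq))
  ... | no _ | no _ = inj₂-injective eq

  colour : V → ℤ₅
  colour = Sum.[ label X , label Y ]

  fromY-colour : ∀ y → colour (fromY y) ≡ label Y y
  fromY-colour y with KY.Core? y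
  ... | yes (c , _ , refl) = trans (label-pres f c) (sym (label-pres g c))
  ... | no _ = refl

  EdgeX : V → V → Set
  EdgeX u v = Σ[ x ∈ Fin (size X) ] Σ[ x′ ∈ Fin (size X) ] inj₁ x ≡ u × inj₁ x′ ≡ v × Adj X x x′

  EdgeY : V → V → Set
  EdgeY u v = Σ[ y ∈ Fin (size Y) ] Σ[ y′ ∈ Fin (size Y) ] fromY y ≡ u × fromY y′ ≡ v × Adj Y y y′

  _~_ : V → V → Set
  u ~ v = EdgeX u v ⊎ EdgeY u v

  _≟ᵛ_ : (u v : V) → Dec (u ≡ v)
  _≟ᵛ_ = ≡-dec Fin._≟_ Fin._≟_

  _~?_ : ∀ u v → Dec (u ~ v)
  u ~? v = edgeX? ⊎-dec edgeY?
    where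
    edgeX? : Dec (EdgeX u v)
    edgeX? = Fin.any? λ x → Fin.any? λ x′ → inj₁ x ≟ᵛ u ×-dec inj₁ x′ ≟ᵛ v ×-dec adj X x x′ ≟ᵇ true
    edgeY? : Dec (EdgeY u v)
    edgeY? = Fin.any? λ y → Fin.any? λ y′ → fromY y ≟ᵛ u ×-dec fromY y′ ≟ᵛ v ×-dec adj Y y y′ ≟ᵇ true

  ~-sym : ∀ {u v} → u ~ v → v ~ u
  ~-sym (inj₁ (x , x′ , p , q , x~x′)) = inj₁ (x′ , x , q , p , Adj-sym X x~x′)
  ~-sym (inj₂ (y , y′ , p , q , y~y′)) = inj₂ (y′ , y , q , p , Adj-sym Y y~y′)

  ~-irrefl : ∀ {v} → ¬ v ~ v
  ~-irrefl (inj₁ (x , x′ , refl , q , x~x′)) with refl ← inj₁-injective q = Adj-irrefl X x~x′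
  ~-irrefl (inj₂ (y , y′ , p , q , y~y′)) with refl ← fromY-injective (trans p (sym q)) = Adj-irrefl Y y~y′

  graphOn : GraphOn V
  graphOn = record { _~_ = _~_ ; _~?_ = _~?_ ; ~-sym = ~-sym ; ~-irrefl = ~-irrefl ; colour = colour }

  -- A core vertex sees X and Y at once; its committed neighbour ℓ, present on both
  -- sides, completes a forbidden pair on one of them.
  noMixedPair : LabelCond X → LabelCond Y → ∀ {c xa yb} → Core c →
                Adj X (map f c) xa → Adj Y (map g c) yb →
                (label X xa ≡ label Z c +₅ 1 × label Y yb ≡ label Z c +₅ 2) ⊎
                (label Y yb ≡ label Z c +₅ 1 × label X xa ≡ label Z c +₅ 2) → ⊥
  noMixedPair lcX lcY {c} {xa} {yb} c∈C fc~xa gc~yb = pairUp (committed c∈C)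
    where
    inX : ∀ {a k} → label X a ≡ label Z c +₅ k → label X a ≡ label X (map f c) +₅ k
    inX {k = k} e = trans e (cong (_+₅ k) (sym (label-pres f c)))
    inY : ∀ {b k} → label Y b ≡ label Z c +₅ k → label Y b ≡ label Y (map g c) +₅ k
    inY {k = k} e = trans e (cong (_+₅ k) (sym (label-pres g c)))
    pairUp : Σ[ ℓ ∈ Fin (size Z) ] Adj Z c ℓ × (label Z ℓ ≡ label Z c +₅ 1 ⊎ label Z ℓ ≡ label Z c +₅ 2) →
             (label X xa ≡ label Z c +₅ 1 × label Y yb ≡ label Z c +₅ 2) ⊎
             (label Y yb ≡ label Z c +₅ 1 × label X xa ≡ label Z c +₅ 2) → ⊥
    pairUp (ℓ , c~ℓ , inj₁ ℓ+1) (inj₁ (_ , yb+2)) =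
      lcY (map g c) (map g ℓ) yb (Adj-preserve g c~ℓ) gc~yb (inY (trans (label-pres g ℓ) ℓ+1)) (inY yb+2)
    pairUp (ℓ , c~ℓ , inj₁ ℓ+1) (inj₂ (_ , xa+2)) =
      lcX (map f c) (map f ℓ) xa (Adj-preserve f c~ℓ) fc~xa (inX (trans (label-pres f ℓ) ℓ+1)) (inX xa+2)
    pairUp (ℓ , c~ℓ , inj₂ ℓ+2) (inj₁ (xa+1 , _)) =
      lcX (map f c) xa (map f ℓ) fc~xa (Adj-preserve f c~ℓ) (inX xa+1) (inX (trans (label-pres f ℓ) ℓ+2))
    pairUp (ℓ , c~ℓ , inj₂ ℓ+2) (inj₂ (yb+1 , _)) =
      lcY (map g c) yb (map g ℓ) gc~yb (Adj-preserve g c~ℓ) (inY yb+1) (inY (trans (label-pres g ℓ) ℓ+2))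

  noBadPair : LabelCond X → LabelCond Y → NoBadPair _~_ colour
  noBadPair lcX lcY _ _ _ (inj₁ (x , xa , refl , refl , x~xa)) (inj₁ (_ , xb , eq , refl , x~xb)) a+1 b+2
    with refl ← inj₁-injective eq = lcX x xa xb x~xa x~xb a+1 b+2
  noBadPair lcX lcY _ _ _ (inj₂ (y , ya , refl , refl , y~ya)) (inj₂ (_ , yb , eq , refl , y~yb)) a+1 b+2
    with refl ← fromY-injective eq = lcY y ya yb y~ya y~yb (inY a+1) (inY b+2)
    where
    inY : ∀ {a k} → colour (fromY a) ≡ colour (fromY y) +₅ k → label Y a ≡ label Y y +₅ k
    inY {a} {k} e = trans (sym (fromY-colour a)) (trans e (cong (_+₅ k) (fromY-colour y)))
  noBadPair lcX lcY _ _ _ (inj₁ (_ , xa , refl , refl , x~xa)) (inj₂ (_ , yb , eq , refl , y~yb)) a+1 b+2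
    with c , c∈C , refl , refl ← fromY≡inj₁ eq =
    noMixedPair lcX lcY c∈C x~xa y~yb (inj₁ (inZ a+1 , trans (sym (fromY-colour yb)) (inZ b+2)))
    where
    inZ : ∀ {l k} → l ≡ label X (map f c) +₅ k → l ≡ label Z c +₅ k
    inZ {k = k} e = trans e (cong (_+₅ k) (label-pres f c))
  noBadPair lcX lcY _ _ _ (inj₂ (_ , ya , refl , refl , y~ya)) (inj₁ (_ , xb , eq , refl , x~xb)) a+1 b+2
    with c , c∈C , refl , refl ← fromY≡inj₁ (sym eq) =
    noMixedPair lcX lcY c∈C x~xb y~ya (inj₂ (trans (sym (fromY-colour ya)) (inZ a+1) , inZ b+2))
    where
    inZ : ∀ {l k} → l ≡ colour (fromY (map g c)) +₅ k → l ≡ label Z c +₅ k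
    inZ {k = k} e = trans e (cong (_+₅ k) (trans (fromY-colour (map g c)) (label-pres g c)))

  open Realise Fin.+↔⊎ graphOn public using (graph)
  open Realise Fin.+↔⊎ graphOn using (Adj⇒~; to-from; from-to; labelCond) renaming (embedding to embedInto)

  f′ : Emb X graph
  f′ = embedInto X inj₁ inj₁-injective reflect (λ x~x′ → inj₁ (_ , _ , refl , refl , x~x′)) (λ _ → refl)
    where
    reflect : ∀ {x x′} → inj₁ x ~ inj₁ x′ → Adj X x x′
    reflect (inj₁ (_ , _ , refl , refl , x~x′)) = x~x′
    reflect (inj₂ (_ , _ , p , q , y~y′))
      with _ , _ , refl , refl ← fromY≡inj₁ p | _ , _ , refl , refl ← fromY≡inj₁ q =
      Adj-preserve f (Adj-reflect g y~y′)

  g′ : Emb Y graph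
  g′ = embedInto Y fromY fromY-injective reflect (λ y~y′ → inj₂ (_ , _ , refl , refl , y~y′)) fromY-colour
    where
    reflect : ∀ {y y′} → fromY y ~ fromY y′ → Adj Y y y′
    reflect (inj₂ (_ , _ , p , q , y~y′)) with refl ← fromY-injective p | refl ← fromY-injective q = y~y′
    reflect (inj₁ (_ , _ , p , q , x~x′))
      with _ , _ , refl , refl ← fromY≡inj₁ (sym p) | _ , _ , refl , refl ← fromY≡inj₁ (sym q) =
      Adj-preserve g (Adj-reflect f x~x′)

  agree : ∀ {c} → Core c → map f′ (map f c) ≡ map g′ (map g c)
  agree c∈C = cong (Inverse.from Fin.+↔⊎) (sym (fromY-core c∈C))

  InX : Fin (size graph) → Set
  InX i = Σ[ x ∈ Fin (size X) ] map f′ x ≡ i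

  InY : Fin (size graph) → Set
  InY i = Σ[ y ∈ Fin (size Y) ] map g′ y ≡ i

  InX-or-InY : ∀ {i j} → Adj graph i j → InX i ⊎ InY i
  InX-or-InY {i} i~j with Adj⇒~ i~j
  ... | inj₁ (x , _ , p , _ , _) = inj₁ (x , trans (cong (Inverse.from Fin.+↔⊎) p) (from-to i))
  ... | inj₂ (y , _ , p , _ , _) = inj₂ (y , trans (cong (Inverse.from Fin.+↔⊎) p) (from-to i))

  neighbours-InY : ∀ {y j} → ¬ KY.Core y → Adj graph (map g′ y) j → InY j
  neighbours-InY {y} {j} y∉C gy~j with subst (_~ _) (to-from (fromY y)) (Adj⇒~ gy~j)
  ... | inj₁ (_ , _ , p , _ , _) with c , c∈C , _ , refl ← fromY≡inj₁ (sym p) = ⊥-elim (y∉C (c , c∈C , refl))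
  ... | inj₂ (_ , y′ , _ , q , _) = y′ , trans (cong (Inverse.from Fin.+↔⊎) q) (from-to j)

  inX? : ∀ i → Dec (InX i)
  inX? i = Fin.any? λ x → map f′ x Fin.≟ i

  acyclic : Acyclic X → Acyclic Y → Acyclic graph
  acyclic acX acY C with Fin.all? (λ t → inX? (Cycle.verts C t))
  ... | yes allInX = acX (Cycle-pullback f′ C allInX)
  ... | no ¬allInX with t , t∉X ← Fin.¬∀⟶∃¬ _ _ (λ t → inX? (Cycle.verts C t)) ¬allInX
    with _ , _ , _ , t~a , _ ← onCycle-twoNeighbours C (t , refl) | InX-or-InY t~a
  ...   | inj₁ t∈X = t∉X t∈X
  ...   | inj₂ (y , gy≡t) =
    noTwoNeighbourSetBeside-core acY (RootedCore-image g K) T ((t , sym gy≡t) , y∉C) proj₂ branching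
    where
    T : Fin (size Y) → Set
    T y = OnCycle C (map g′ y) × ¬ KY.Core y
    y∉C : ¬ KY.Core y
    y∉C (c , c∈C , refl) = t∉X (map f c , trans (agree c∈C) gy≡t)
    sortOut : ∀ {y a} → Adj Y y a → OnCycle C (map g′ a) → (T ∪ KY.Core) a
    sortOut {a = a} _ a∈C with KY.Core? a
    ... | yes a∈K = inj₂ a∈K
    ... | no a∉K  = inj₁ (a∈C , a∉K)
    branching : ∀ {y} → T y → TwoNeighboursIn Y (T ∪ KY.Core) y
    branching (y∈C , y∉K) = TwoNeighboursIn-mono Y sortOut
      (TwoNeighboursIn-reflect g′ (neighbours-InY y∉K) (onCycle-twoNeighbours C y∈C))

  inK : InK X → InK Y → InK graph
  inK (acX , lcX) (acY , lcY) = acyclic acX acY , labelCond (noBadPair lcX lcY)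

amalgamation : ∀ {Z X Y} (K : RootedCore Z) → Committed Z (RootedCore.Core K) → InK X → InK Y →
               (f : Emb Z X) (g : Emb Z Y) →
               Σ LGraph λ W → InK W × Σ (Emb X W) λ f′ → Σ (Emb Y W) λ g′ →
                 ∀ {c} → RootedCore.Core K c → map f′ (map f c) ≡ map g′ (map g c)
amalgamation K committed inKX inKY f g = A.graph , A.inK inKX inKY , A.f′ , A.g′ , A.agree
  where module A = Amalgamation K committed f g

mainTheorem3 : WAP InK
mainTheorem3 Z (acyclic , lc) = L.graph , L.inK (S.inK lc) , L.embedding ∘ᴱ S.embedding ,
  λ X Y inKX inKY f g →
    let W , inKW , f′ , g′ , agree = amalgamation core committed inKX inKY f g
    in  W , inKW , f′ , g′ , λ z → agree (map S.embedding z , tt , refl)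
  where
  module S = Spine Z (proj₂ (acyclic⇒ranking Z acyclic))
  module L = WithLeaves S.graph
  core : RootedCore L.graph
  core = RootedCore-image L.embedding S.core
  committed : Committed L.graph (RootedCore.Core core)
  committed (c , _ , refl) = L.committed c
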